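{- Let $\mathsf{K}$ be a small $\mathsf{DCpo}^\vee$-enriched category. The category $\widetilde{\mathsf{K}}=[\mathsf{K},\mathsf{DCpo}^\vee]$ is right distributive $\mathsf{DCpo}^\vee$-enriched. Consequently, $\widetilde{\mathsf{K}}^{op}$ is left distributive $\mathsf{DCpo}^\vee$-enriched.
   Context: $\mathsf{DCpo}^\vee$ is the category whose objects are posets having suprema of all directed subsets and all binary joins, and whose morphisms are Scott-continuous maps (monotone maps preserving directed suprema); it is order enriched by the pointwise order. A category is $\mathsf{DCpo}^\vee$-enriched if every hom-set is such a poset and composition is monotone and preserves directed suprema in each variable. $\widetilde{\mathsf{K}}=[\mathsf{K},\mathsf{DCpo}^\vee]$ has as objects lax functors $\pi:\mathsf{K}\to\mathsf{DCpo}^\vee$ (so $id\leq\pi(id)$ and $\pi(g)\circ\pi(h)\leq\pi(g\circ h)$ pointwise) and as morphisms oplax transformations $f:\pi\to\pi'$ (families $f_X:\pi X\to\pi'X$ with $f_{X'}\circ\pi(g)\leq\pi'(g)\circ f_X$ for $g:X\to X'$), ordered by $f\leq g$ iff $f_X(x)\leq g_X(x)$ for all $X$ and $x\in\pi X$. Right distributive: $(f\vee g)\circ h=f\circ h\vee g\circ h$; left distributive: $h\circ(f\vee g)=h\circ f\vee h\circ g$. -}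

module Defs where

open import Level using (Level; _⊔_; suc)
open import Data.Product using (Σ; Σ-syntax; _×_; _,_; proj₁; proj₂)

-- Directed subsets are represented by directed families α : I → A
-- (I in the same universe as the carrier), the usual constructive rendering.

module _ {a r : Level} {A : Set a} (_≤_ : A → A → Set r) where

  Directed : {i : Level} {I : Set i} → (I → A) → Set (i ⊔ r)
  Directed {I = I} α = I × (∀ i j → Σ[ k ∈ I ] (α i ≤ α k × α j ≤ α k))

  IsLUB : {i : Level} {I : Set i} → (I → A) → A → Set (a ⊔ i ⊔ r)
  IsLUB α s = (∀ i → α i ≤ s) × (∀ b → (∀ i → α i ≤ b) → s ≤ b)

  IsJoin : A → A → A → Set (a ⊔ r)
  IsJoin x y s = x ≤ s × y ≤ s × (∀ b → x ≤ b → y ≤ b → s ≤ b)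

-- Objects of DCpo^∨: (pre)ordered sets with all directed suprema and all
-- binary joins.  Equality of elements is x ≤ y × y ≤ x (antisymmetric
-- quotient), so a preorder suffices.

record DCpoV (ℓ : Level) : Set (suc ℓ) where
  field
    Carrier : Set ℓ
    _≤_     : Carrier → Carrier → Set ℓ
    ≤-refl  : ∀ {x} → x ≤ x
    ≤-trans : ∀ {x y z} → x ≤ y → y ≤ z → x ≤ z
    dsup    : ∀ {I : Set ℓ} (α : I → Carrier) → Directed _≤_ α →
              Σ[ s ∈ Carrier ] IsLUB _≤_ α s
    join    : ∀ x y → Σ[ s ∈ Carrier ] IsJoin _≤_ x y s

open DCpoV public using (Carrier)

record ScottMap {ℓ : Level} (A B : DCpoV ℓ) : Set (suc ℓ) where
  private
    module A = DCpoV A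
    module B = DCpoV B
  field
    fun  : A.Carrier → B.Carrier
    mono : ∀ {x y} → x A.≤ y → fun x B.≤ fun y
    pres : ∀ {I : Set ℓ} (α : I → A.Carrier) → Directed A._≤_ α →
           ∀ s → IsLUB A._≤_ α s → IsLUB B._≤_ (λ i → fun (α i)) (fun s)

open ScottMap public using (fun)

idS : ∀ {ℓ} (A : DCpoV ℓ) → ScottMap A A
idS A = record { fun = λ x → x ; mono = λ p → p ; pres = λ α d s l → l }

_∘S_ : ∀ {ℓ} {A B C : DCpoV ℓ} → ScottMap B C → ScottMap A B → ScottMap A C
_∘S_ {A = A} {B} {C} g f = record
  { fun  = λ x → fun g (fun f x)
  ; mono = λ p → ScottMap.mono g (ScottMap.mono f p)
  ; pres = λ α d s l → ScottMap.pres g (λ i → fun f (α i))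
             (proj₁ d , λ i j → let (k , p , q) = proj₂ d i j
                                 in k , ScottMap.mono f p , ScottMap.mono f q)
             (fun f s) (ScottMap.pres f α d s l)
  }

record OrdCat (o h r : Level) : Set (suc (o ⊔ h ⊔ r)) where
  infixr 9 _∘_
  infix 4 _≤_ _≈_
  field
    Obj : Set o
    Hom : Obj → Obj → Set h
    _≤_ : ∀ {A B} → Hom A B → Hom A B → Set r
    _∘_ : ∀ {A B C} → Hom B C → Hom A B → Hom A C
    id  : ∀ {A} → Hom A A

  _≈_ : ∀ {A B} → Hom A B → Hom A B → Set r
  f ≈ g = f ≤ g × g ≤ f

op : ∀ {o h r} → OrdCat o h r → OrdCat o h r
op C = record
  { Obj = Obj ; Hom = λ A B → Hom B A ; _≤_ = _≤_
  ; _∘_ = λ f g → g ∘ f ; id = id }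
  where open OrdCat C

record IsDCpoVEnriched {o h r : Level} (ι : Level) (C : OrdCat o h r)
       : Set (o ⊔ h ⊔ r ⊔ suc ι) where
  open OrdCat C
  field
    ≤-refl  : ∀ {X Y} {f : Hom X Y} → f ≤ f
    ≤-trans : ∀ {X Y} {f g k : Hom X Y} → f ≤ g → g ≤ k → f ≤ k
    dsup    : ∀ {X Y} {I : Set ι} (α : I → Hom X Y) → Directed _≤_ α →
              Σ[ s ∈ Hom X Y ] IsLUB _≤_ α s
    join    : ∀ {X Y} (f g : Hom X Y) → Σ[ s ∈ Hom X Y ] IsJoin _≤_ f g s
    assoc   : ∀ {W X Y Z} (k : Hom Y Z) (g : Hom X Y) (f : Hom W X) →
              (k ∘ g) ∘ f ≈ k ∘ (g ∘ f)
    identityˡ : ∀ {X Y} (f : Hom X Y) → id ∘ f ≈ f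
    identityʳ : ∀ {X Y} (f : Hom X Y) → f ∘ id ≈ f
    ∘-monoˡ : ∀ {X Y Z} {g g' : Hom Y Z} (f : Hom X Y) → g ≤ g' → g ∘ f ≤ g' ∘ f
    ∘-monoʳ : ∀ {X Y Z} (g : Hom Y Z) {f f' : Hom X Y} → f ≤ f' → g ∘ f ≤ g ∘ f'
    ∘-presˡ : ∀ {X Y Z} {I : Set ι} (α : I → Hom Y Z) → Directed _≤_ α →
              ∀ s → IsLUB _≤_ α s → (f : Hom X Y) →
              IsLUB _≤_ (λ i → α i ∘ f) (s ∘ f)
    ∘-presʳ : ∀ {X Y Z} {I : Set ι} (g : Hom Y Z) (α : I → Hom X Y) →
              Directed _≤_ α → ∀ s → IsLUB _≤_ α s →
              IsLUB _≤_ (λ i → g ∘ α i) (g ∘ s)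

RightDistributive : ∀ {o h r} → OrdCat o h r → Set (o ⊔ h ⊔ r)
RightDistributive C =
  ∀ {X Y Z} (f g : Hom Y Z) (k : Hom X Y) (j : Hom Y Z) (m : Hom X Z) →
  IsJoin _≤_ f g j → IsJoin _≤_ (f ∘ k) (g ∘ k) m → (j ∘ k) ≈ m
  where open OrdCat C

LeftDistributive : ∀ {o h r} → OrdCat o h r → Set (o ⊔ h ⊔ r)
LeftDistributive C =
  ∀ {X Y Z} (k : Hom Y Z) (f g : Hom X Y) (j : Hom X Y) (m : Hom X Z) →
  IsJoin _≤_ f g j → IsJoin _≤_ (k ∘ f) (k ∘ g) m → (k ∘ j) ≈ m
  where open OrdCat C

record SmallDCpoVCat (ℓ : Level) : Set (suc ℓ) where
  field
    cat        : OrdCat ℓ ℓ ℓ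
    isEnriched : IsDCpoVEnriched ℓ cat
  open OrdCat cat public

-- K̃ = [K, DCpo^∨]: lax functors and oplax transformations.

module _ {ℓ : Level} (K : SmallDCpoVCat ℓ) where
  private module K = SmallDCpoVCat K

  record LaxFunctor : Set (suc ℓ) where
    field
      F₀     : K.Obj → DCpoV ℓ
      F₁     : ∀ {X Y} → K.Hom X Y → ScottMap (F₀ X) (F₀ Y)
      lax-id : ∀ X (x : Carrier (F₀ X)) → DCpoV._≤_ (F₀ X) x (fun (F₁ K.id) x)
      lax-∘  : ∀ {X Y Z} (g : K.Hom Y Z) (h : K.Hom X Y) (x : Carrier (F₀ X)) →
               DCpoV._≤_ (F₀ Z) (fun (F₁ g) (fun (F₁ h) x)) (fun (F₁ (g K.∘ h)) x)

  open LaxFunctor public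

  record OplaxTrans (π π' : LaxFunctor) : Set (suc ℓ) where
    field
      η     : ∀ X → ScottMap (F₀ π X) (F₀ π' X)
      oplax : ∀ {X X'} (g : K.Hom X X') (x : Carrier (F₀ π X)) →
              DCpoV._≤_ (F₀ π' X') (fun (η X') (fun (F₁ π g) x))
                                    (fun (F₁ π' g) (fun (η X) x))

  open OplaxTrans public

  _≤T_ : ∀ {π π'} → OplaxTrans π π' → OplaxTrans π π' → Set ℓ
  _≤T_ {π} {π'} f g = ∀ X (x : Carrier (F₀ π X)) →
                      DCpoV._≤_ (F₀ π' X) (fun (η f X) x) (fun (η g X) x)

  idT : ∀ {π} → OplaxTrans π π
  idT {π} = record
    { η = λ X → idS (F₀ π X)
    ; oplax = λ {X} {X'} g x → DCpoV.≤-refl (F₀ π X') }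

  _∘T_ : ∀ {π π' π''} → OplaxTrans π' π'' → OplaxTrans π π' → OplaxTrans π π''
  _∘T_ {π} {π'} {π''} θ φ = record
    { η = λ X → η θ X ∘S η φ X
    ; oplax = λ {X} {X'} g x →
        DCpoV.≤-trans (F₀ π'' X')
          (ScottMap.mono (η θ X') (oplax φ g x))
          (oplax θ g (fun (η φ X) x)) }

  Tilde : OrdCat (suc ℓ) (suc ℓ) ℓ
  Tilde = record
    { Obj = LaxFunctor ; Hom = OplaxTrans ; _≤_ = _≤T_
    ; _∘_ = _∘T_ ; id = idT }

module Submission where

-- In K̃ = [K, DCpo^∨] a family of oplax transformations
-- π → π' whose components have least upper bounds pointwise (at every
-- object X and every x ∈ π X) has, as its least upper bound in the hom-order,
-- the transformation computed pointwise: pointwise suprema of Scott-continuous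
-- maps are Scott-continuous, and the oplax inequality passes to pointwise
-- suprema.  Conversely, since such a pointwise supremum exists for directed
-- families and for pairs (π' X is in DCpo^∨), every directed supremum and
-- every binary join in a hom-set of K̃ is computed pointwise.  Binary joins
-- are treated as suprema of Bool-indexed families, so one construction
-- serves both.
--
-- The enrichment of K̃ follows: composition is pointwise function composition,
-- so g ∘ (sup α) = sup (g ∘ α) by Scott-continuity of the components of g,
-- and (sup α) ∘ f = sup (α ∘ f) because suprema are taken pointwise.  Right distributivity holds because
-- ((f ∨ g) ∘ k) X x = (f ∨ g) X (k X x) is the join of f X (k X x) and
-- g X (k X x); joins being unique, (f ∨ g) ∘ k ≈ f ∘ k ∨ g ∘ k.  Finally, two
-- general facts about arbitrary order-enriched categories — the opposite of a
-- DCpo^∨-enriched category is DCpo^∨-enriched, and the opposite of a right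
-- distributive one is left distributive — give the statement about K̃^op.

open import Level using (Level)
open import Data.Bool using (Bool; true; false)
open import Data.Product using (Σ-syntax; _×_; _,_; proj₁; proj₂; swap)
open import Defs

pair : ∀ {a} {A : Set a} → A → A → Bool → A
pair x y true  = x
pair x y false = y

module _ {a r : Level} {A : Set a} (_≤_ : A → A → Set r) where

  lub⇒join : ∀ {α : Bool → A} {s} → IsLUB _≤_ α s → IsJoin _≤_ (α true) (α false) s
  lub⇒join (ub , least) =
    ub true , ub false , λ b x≤b y≤b → least b λ { true → x≤b ; false → y≤b }

  join⇒lub : ∀ {α : Bool → A} {s} → IsJoin _≤_ (α true) (α false) s → IsLUB _≤_ α s
  join⇒lub (x≤s , y≤s , least) =
    (λ { true → x≤s ; false → y≤s }) , λ b ub → least b (ub true) (ub false)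

  join-unique : ∀ {x y s t} → IsJoin _≤_ x y s → IsJoin _≤_ x y t → s ≤ t × t ≤ s
  join-unique (x≤s , y≤s , s-least) (x≤t , y≤t , t-least) =
    s-least _ x≤t y≤t , t-least _ x≤s y≤s

-- In DCpo^∨, a pointwise supremum σ of any family φ of Scott-continuous maps
-- is again Scott-continuous: suprema commute with suprema.
lubMap : ∀ {ℓ j} {A B : DCpoV ℓ} {J : Set j} (φ : J → ScottMap A B)
         (σ : Carrier A → Carrier B) →
         (∀ x → IsLUB (DCpoV._≤_ B) (λ i → fun (φ i) x) (σ x)) → ScottMap A B
lubMap {A = A} {B} φ σ σ-lub = record { fun = σ ; mono = σ-mono ; pres = σ-pres }
  where
    module A = DCpoV A
    module B = DCpoV B

    σ-mono : ∀ {x y} → x A.≤ y → σ x B.≤ σ y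
    σ-mono {x} {y} x≤y = proj₂ (σ-lub x) (σ y) λ i →
      B.≤-trans (ScottMap.mono (φ i) x≤y) (proj₁ (σ-lub y) i)

    -- σ t is below every upper bound b of the σ (β k), because each φ i t
    -- is the supremum of the φ i (β k), all of which lie below b.
    σ-pres : ∀ {I : Set _} (β : I → A.Carrier) → Directed A._≤_ β →
             ∀ t → IsLUB A._≤_ β t → IsLUB B._≤_ (λ k → σ (β k)) (σ t)
    σ-pres β β-dir t t-lub = (λ k → σ-mono (proj₁ t-lub k)) , λ b b-ub →
      proj₂ (σ-lub t) b λ i →
        proj₂ (ScottMap.pres (φ i) β β-dir t t-lub) b λ k →
          B.≤-trans (proj₁ (σ-lub (β k)) i) (b-ub k)

module Pointwise {ℓ : Level} (K : SmallDCpoVCat ℓ) where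

  module _ {π π' : LaxFunctor K} where
    private
      Trans : Set (Level.suc ℓ)
      Trans = OplaxTrans K π π'

      _⊑_ : Trans → Trans → Set ℓ
      _⊑_ = _≤T_ K

      module Cod X = DCpoV (F₀ π' X)

    app : Trans → ∀ X → Carrier (F₀ π X) → Carrier (F₀ π' X)
    app f X x = fun (η f X) x

    ⊑-refl : ∀ {f} → f ⊑ f
    ⊑-refl X x = Cod.≤-refl X

    ⊑-trans : ∀ {f g k} → f ⊑ g → g ⊑ k → f ⊑ k
    ⊑-trans f≤g g≤k X x = Cod.≤-trans X (f≤g X x) (g≤k X x)

    -- used where the two sides of a categorical law are definitionally equal
    ≈-refl : (f : Trans) → f ⊑ f × f ⊑ f
    ≈-refl f = ⊑-refl {f} , ⊑-refl {f}

    PointwiseLUB : ∀ {ι} {J : Set ι} → (J → Trans) →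
                   (∀ X → Carrier (F₀ π X) → Carrier (F₀ π' X)) → Set _
    PointwiseLUB φ σ = ∀ X x → IsLUB (Cod._≤_ X) (λ i → app (φ i) X x) (σ X x)

    HasPointwiseLUB : ∀ {ι} {J : Set ι} → (J → Trans) → Set _
    HasPointwiseLUB φ = Σ[ σ ∈ (∀ X → Carrier (F₀ π X) → Carrier (F₀ π' X)) ]
                        PointwiseLUB φ σ

    pointwise⇒LUB : ∀ {ι} {J : Set ι} (φ : J → Trans) (s : Trans) →
                    PointwiseLUB φ (app s) → IsLUB _⊑_ φ s
    pointwise⇒LUB φ s s-lub =
      (λ i X x → proj₁ (s-lub X x) i) ,
      λ b b-ub X x → proj₂ (s-lub X x) (app b X x) λ i → b-ub i X x

    -- The pointwise supremum of oplax transformations is oplax: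
    -- φ i (π g x) ≤ π' g (φ i x) ≤ π' g (σ x) for every i.
    lubTrans : ∀ {ι} {J : Set ι} (φ : J → Trans) → HasPointwiseLUB φ → Trans
    lubTrans φ (σ , σ-lub) = record
      { η     = λ X → lubMap (λ i → η (φ i) X) (σ X) (σ-lub X)
      ; oplax = λ {X} {X'} g x → proj₂ (σ-lub X' (fun (F₁ π g) x)) _ λ i →
          Cod.≤-trans X' (oplax (φ i) g x)
                         (ScottMap.mono (F₁ π' g) (proj₁ (σ-lub X x) i))
      }

    lubTrans-isLUB : ∀ {ι} {J : Set ι} (φ : J → Trans) (σ : HasPointwiseLUB φ) →
                     IsLUB _⊑_ φ (lubTrans φ σ)
    lubTrans-isLUB φ σ = pointwise⇒LUB φ (lubTrans φ σ) (proj₂ σ)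

    -- When a pointwise supremum exists, every hom-supremum s lies below it
    -- and is therefore itself a pointwise supremum.
    LUB⇒pointwise : ∀ {ι} {J : Set ι} (φ : J → Trans) → HasPointwiseLUB φ →
                    ∀ s → IsLUB _⊑_ φ s → PointwiseLUB φ (app s)
    LUB⇒pointwise φ σ s (s-ub , s-least) X x =
      (λ i → s-ub i X x) ,
      λ b b-ub → Cod.≤-trans X (s≤σ X x) (proj₂ (proj₂ σ X x) b b-ub)
      where
        s≤σ : s ⊑ lubTrans φ σ
        s≤σ = s-least (lubTrans φ σ) (proj₁ (lubTrans-isLUB φ σ))

    directed-at : {I : Set ℓ} (φ : I → Trans) → Directed _⊑_ φ →
                  ∀ X x → Directed (Cod._≤_ X) (λ i → app (φ i) X x)
    directed-at φ (i₀ , bound) X x = i₀ , λ i j →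
      let (k , i≤k , j≤k) = bound i j in k , i≤k X x , j≤k X x

    directed-pointwiseLUB : {I : Set ℓ} (φ : I → Trans) → Directed _⊑_ φ →
                            HasPointwiseLUB φ
    directed-pointwiseLUB φ φ-dir =
      (λ X x → proj₁ (Cod.dsup X _ (directed-at φ φ-dir X x))) ,
      (λ X x → proj₂ (Cod.dsup X _ (directed-at φ φ-dir X x)))

    pair-pointwiseLUB : (f g : Trans) → HasPointwiseLUB (pair f g)
    pair-pointwiseLUB f g =
      (λ X x → proj₁ (Cod.join X (app f X x) (app g X x))) ,
      (λ X x → join⇒lub (Cod._≤_ X) (proj₂ (Cod.join X (app f X x) (app g X x))))

    dsupTrans : {I : Set ℓ} (φ : I → Trans) → Directed _⊑_ φ →
                Σ[ s ∈ Trans ] IsLUB _⊑_ φ s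
    dsupTrans φ φ-dir = lubTrans φ σ , lubTrans-isLUB φ σ
      where
        σ : HasPointwiseLUB φ
        σ = directed-pointwiseLUB φ φ-dir

    joinTrans : (f g : Trans) → Σ[ s ∈ Trans ] IsJoin _⊑_ f g s
    joinTrans f g = s , lub⇒join _⊑_ {α = pair f g} {s} (lubTrans-isLUB (pair f g) σ)
      where
        σ : HasPointwiseLUB (pair f g)
        σ = pair-pointwiseLUB f g

        s : Trans
        s = lubTrans (pair f g) σ

    join-pointwise : ∀ {f g j} → IsJoin _⊑_ f g j →
                     ∀ X x → IsJoin (Cod._≤_ X) (app f X x) (app g X x) (app j X x)
    join-pointwise {f} {g} {j} j-join X x =
      lub⇒join (Cod._≤_ X) (LUB⇒pointwise (pair f g) (pair-pointwiseLUB f g) j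
                              (join⇒lub _⊑_ {α = pair f g} {j} j-join) X x)

    pointwise⇒join : ∀ {f g j} →
                     (∀ X x → IsJoin (Cod._≤_ X) (app f X x) (app g X x) (app j X x)) →
                     IsJoin _⊑_ f g j
    pointwise⇒join {f} {g} {j} j-join =
      lub⇒join _⊑_ {α = pair f g} {j}
        (pointwise⇒LUB (pair f g) j λ X x → join⇒lub (Cod._≤_ X) (j-join X x))

open Pointwise using (app; ⊑-refl; ⊑-trans; ≈-refl; dsupTrans; joinTrans;
                      pointwise⇒LUB; LUB⇒pointwise; directed-at;
                      directed-pointwiseLUB; join-pointwise; pointwise⇒join)

tilde-enriched : ∀ {ℓ} (K : SmallDCpoVCat ℓ) → IsDCpoVEnriched ℓ (Tilde K)
tilde-enriched K = record
  { ≤-refl    = λ {_} {_} {f} → ⊑-refl K {f = f}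
  ; ≤-trans   = λ {_} {_} {f} {g} {k} → ⊑-trans K {f = f} {g} {k}
  ; dsup      = dsupTrans K
  ; join      = joinTrans K
  ; assoc     = λ k g f → ≈-refl K (_∘T_ K k (_∘T_ K g f))
  ; identityˡ = ≈-refl K
  ; identityʳ = ≈-refl K
  ; ∘-monoˡ   = λ f g≤g' X x → g≤g' X (app K f X x)
  ; ∘-monoʳ   = λ g f≤f' X x → ScottMap.mono (η g X) (f≤f' X x)
  ; ∘-presˡ   = λ α α-dir s s-lub f →
      pointwise⇒LUB K (λ i → _∘T_ K (α i) f) (_∘T_ K s f) λ X x →
        LUB⇒pointwise K α (directed-pointwiseLUB K α α-dir) s s-lub X (app K f X x)
  ; ∘-presʳ   = λ g α α-dir s s-lub →
      pointwise⇒LUB K (λ i → _∘T_ K g (α i)) (_∘T_ K g s) λ X x →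
        ScottMap.pres (η g X) _ (directed-at K α α-dir X x) _
          (LUB⇒pointwise K α (directed-pointwiseLUB K α α-dir) s s-lub X x)
  }

-- K̃ is right distributive: (f ∨ g) ∘ k is pointwise the join of f ∘ k and
-- g ∘ k, hence agrees with any join of them.
tilde-rightDistributive : ∀ {ℓ} (K : SmallDCpoVCat ℓ) → RightDistributive (Tilde K)
tilde-rightDistributive K f g k j m j-join m-join =
  join-unique (_≤T_ K) {x = _∘T_ K f k} {_∘T_ K g k} {_∘T_ K j k} {m}
    (pointwise⇒join K {f = _∘T_ K f k} {_∘T_ K g k} {_∘T_ K j k} λ X x →
       join-pointwise K {f = f} {g} {j} j-join X (app K k X x))
    m-join

-- The opposite of a DCpo^∨-enriched category is DCpo^∨-enriched: the
-- hom-posets are unchanged and the roles of the two variables swap.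
op-enriched : ∀ {o h r ι} {C : OrdCat o h r} →
              IsDCpoVEnriched ι C → IsDCpoVEnriched ι (op C)
op-enriched E = record
  { ≤-refl    = E.≤-refl
  ; ≤-trans   = E.≤-trans
  ; dsup      = E.dsup
  ; join      = E.join
  ; assoc     = λ k g f → swap (E.assoc f g k)
  ; identityˡ = E.identityʳ
  ; identityʳ = E.identityˡ
  ; ∘-monoˡ   = λ f g≤g' → E.∘-monoʳ f g≤g'
  ; ∘-monoʳ   = λ g f≤f' → E.∘-monoˡ g f≤f'
  ; ∘-presˡ   = λ α α-dir s s-lub f → E.∘-presʳ f α α-dir s s-lub
  ; ∘-presʳ   = λ g α α-dir s s-lub → E.∘-presˡ α α-dir s s-lub g
  }
  where module E = IsDCpoVEnriched E

op-leftDistributive : ∀ {o h r} {C : OrdCat o h r} →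
                      RightDistributive C → LeftDistributive (op C)
op-leftDistributive rd k f g = rd f g k

theorem4p1 : ∀ {ℓ} (K : SmallDCpoVCat ℓ) →
    (IsDCpoVEnriched ℓ (Tilde K) × RightDistributive (Tilde K)) ×
    (IsDCpoVEnriched ℓ (op (Tilde K)) × LeftDistributive (op (Tilde K)))
theorem4p1 K =
  (tilde-enriched K , tilde-rightDistributive K) ,
  (op-enriched {C = Tilde K} (tilde-enriched K) ,
   op-leftDistributive {C = Tilde K} (tilde-rightDistributive K))
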